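{- Let $(P,\leq,{}',0,1)$ be a modular poset with complementation. Then it is pseudo-orthomodular if and only if for all $x,y\in P$, \[L\Big(\bigcap_{z\in L(x,y)}\big(U(z,y')\cup\{y\}\big)\Big)\subseteq\bigcup_{z\in L(x,y)}L\big(U(z,y')\cup\{y\}\big).\]
   Context: For a poset $(P,\leq)$ and $A\subseteq P$ let $L(A)=\{x\in P\mid x\leq y\text{ for all }y\in A\}$ and $U(A)=\{x\in P\mid y\leq x\text{ for all }y\in A\}$; we write $L(a,b)$ for $L(\{a,b\})$, $L(A,a)$ for $L(A\cup\{a\})$, etc., and similarly for $U$. A poset is modular if for all $x,y,z$, $x\leq z$ implies $L(U(x,y),z)=L(U(x,L(y,z)))$ (equivalently $U(x,L(y,z))=U(L(U(x,y),z))$). A poset with complementation is $(P,\leq,{}',0,1)$ with $(P,\leq,0,1)$ a bounded poset and $'$ a unary operation such that $L(x,x')=\{0\}$, $U(x,x')=\{1\}$, $x\leq y$ implies $y'\leq x'$, and $(x')'=x$. A pseudo-orthomodular poset is a poset with complementation satisfying $L(U(L(x,y),y'),y)=L(x,y)$ for all $x,y$. -}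

module Defs where

open import Level using (Level; _⊔_)
open import Data.Product using (Σ; _×_; _,_)
open import Data.Sum using (_⊎_)
open import Relation.Binary.Bundles using (Poset)

module PosetSets {ℓ : Level} (P : Poset ℓ ℓ ℓ) where
  open Poset P

  Subset : Set (Level.suc ℓ)
  Subset = Carrier → Set ℓ

  _⊆_ : Subset → Subset → Set ℓ
  A ⊆ B = ∀ x → A x → B x

  _≐_ : Subset → Subset → Set ℓ
  A ≐ B = (A ⊆ B) × (B ⊆ A)

  ⟨_⟩ : Carrier → Subset
  ⟨ a ⟩ x = x ≈ a

  pair : Carrier → Carrier → Subset
  pair a b x = (x ≈ a) ⊎ (x ≈ b)

  _∪_ : Subset → Subset → Subset
  (A ∪ B) x = A x ⊎ B x

  L : Subset → Subset
  L A x = ∀ y → A y → x ≤ y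

  U : Subset → Subset
  U A x = ∀ y → A y → y ≤ x

  L₂ : Carrier → Carrier → Subset
  L₂ a b = L (pair a b)

  U₂ : Carrier → Carrier → Subset
  U₂ a b = U (pair a b)

  IsModular : Set ℓ
  IsModular = ∀ x y z → x ≤ z →
    L (U₂ x y ∪ ⟨ z ⟩) ≐ L (U (⟨ x ⟩ ∪ L₂ y z))

record ComplementedPoset (ℓ : Level) : Set (Level.suc ℓ) where
  field
    poset : Poset ℓ ℓ ℓ
  open Poset poset public
  open PosetSets poset public
  field
    𝟘 𝟙 : Carrier
    𝟘-least : ∀ x → 𝟘 ≤ x
    𝟙-greatest : ∀ x → x ≤ 𝟙
    _′ : Carrier → Carrier
    L-compl : ∀ x → L₂ x (x ′) ≐ ⟨ 𝟘 ⟩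
    U-compl : ∀ x → U₂ x (x ′) ≐ ⟨ 𝟙 ⟩
    ′-antitone : ∀ {x y} → x ≤ y → (y ′) ≤ (x ′)
    ′-involutive : ∀ x → ((x ′) ′) ≈ x

  IsPseudoOrthomodular : Set ℓ
  IsPseudoOrthomodular = ∀ x y →
    L (U (L₂ x y ∪ ⟨ y ′ ⟩) ∪ ⟨ y ⟩) ≐ L₂ x y

  Condition : Set ℓ
  Condition = ∀ x y →
    L (λ w → ∀ z → L₂ x y z → (U₂ z (y ′) ∪ ⟨ y ⟩) w)
      ⊆ (λ w → Σ Carrier λ z → L₂ x y z × L (U₂ z (y ′) ∪ ⟨ y ⟩) w)

module Submission where

-- Fix x, y and write
--   Cap x y = ⋂_{z ∈ L(x,y)} (U(z,y') ∪ {y}),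
--   Up  x y = U(L(x,y),y') ∪ {y},
--   Cup x y = ⋃_{z ∈ L(x,y)} L(U(z,y') ∪ {y}).
-- (1) In every poset with complementation Cap x y = Up x y: "⊇" is immediate,
--     and "⊆" uses that 0 ∈ L(x,y) forces every element of Cap x y other
--     than y to lie above y'.
-- (2) In every modular poset with complementation Cup x y = L(x,y):
--     modularity collapses L(U(z,y'),y) to L(z) whenever z ≤ y, because
--     L(y',y) = {0}; conversely each w ∈ L(x,y) is its own witness z = w.
-- (3) L(x,y) ⊆ L(Up x y) always holds, so pseudo-orthomodularity amounts to
--     L(Up x y) ⊆ L(x,y).
-- By (1) and (2) the Condition reads L(Up x y) ⊆ L(x,y), which is (3).

open import Defs
open import Level using (Level)
open import Relation.Binary.Bundles using (Poset)
open import Data.Product using (Σ; _×_; _,_; proj₁)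
open import Data.Sum using (inj₁; inj₂)

module Cones {ℓ : Level} (P : Poset ℓ ℓ ℓ) where
  open Poset P
  open PosetSets P

  ⊆-trans : {A B C : Subset} → A ⊆ B → B ⊆ C → A ⊆ C
  ⊆-trans A⊆B B⊆C x xA = B⊆C x (A⊆B x xA)

  L-antitone : {A B : Subset} → A ⊆ B → L B ⊆ L A
  L-antitone A⊆B x xLB y yA = xLB y (A⊆B y yA)

  L-∪⟨⟩ : {A : Subset} {a x : Carrier} → L (A ∪ ⟨ a ⟩) x → x ≤ a
  L-∪⟨⟩ xL = xL _ (inj₂ Eq.refl)

  L₂-left : {a b x : Carrier} → L₂ a b x → x ≤ a
  L₂-left xL = xL _ (inj₁ Eq.refl)

  L₂-right : {a b x : Carrier} → L₂ a b x → x ≤ b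
  L₂-right xL = xL _ (inj₂ Eq.refl)

  L₂-intro : {a b x : Carrier} → x ≤ a → x ≤ b → L₂ a b x
  L₂-intro x≤a x≤b v (inj₁ v≈a) = trans x≤a (reflexive (Eq.sym v≈a))
  L₂-intro x≤a x≤b v (inj₂ v≈b) = trans x≤b (reflexive (Eq.sym v≈b))

  L₂-swap : {a b : Carrier} → L₂ a b ⊆ L₂ b a
  L₂-swap x xL = L₂-intro (L₂-right xL) (L₂-left xL)

  -- Modularity rewrites L(U(z,c),y) as L(U(z,L(c,y))), and z ∈ U(z,L(c,y)).
  modular-collapse : IsModular → {z c y : Carrier} → z ≤ y →
    (∀ v → L₂ c y v → v ≤ z) →
    ∀ w → L (U₂ z c ∪ ⟨ y ⟩) w → w ≤ z
  modular-collapse modular {z} {c} {y} z≤y L₂cy≤z w wL =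
    proj₁ (modular z c y z≤y) w wL z z-upper
    where
      z-upper : U (⟨ z ⟩ ∪ L₂ c y) z
      z-upper v (inj₁ v≈z) = reflexive v≈z
      z-upper v (inj₂ vL)  = L₂cy≤z v vL

module Complemented {ℓ : Level} (P : ComplementedPoset ℓ) where
  open ComplementedPoset P
  open Cones poset

  Cap : Carrier → Carrier → Subset
  Cap x y w = ∀ z → L₂ x y z → (U₂ z (y ′) ∪ ⟨ y ⟩) w

  Up : Carrier → Carrier → Subset
  Up x y = U (L₂ x y ∪ ⟨ y ′ ⟩) ∪ ⟨ y ⟩

  Cup : Carrier → Carrier → Subset
  Cup x y w = Σ Carrier λ z → L₂ x y z × L (U₂ z (y ′) ∪ ⟨ y ⟩) w

  Up⊆Cap : ∀ x y → Up x y ⊆ Cap x y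
  Up⊆Cap x y u (inj₁ uU) z zL = inj₁ u-above
    where
      u-above : U₂ z (y ′) u
      u-above v (inj₁ v≈z)  = trans (reflexive v≈z) (uU z (inj₁ zL))
      u-above v (inj₂ v≈y′) = trans (reflexive v≈y′) (uU (y ′) (inj₂ Eq.refl))
  Up⊆Cap x y u (inj₂ u≈y) z zL = inj₂ u≈y

  -- Conversely, testing s ∈ Cap x y at z = 0 shows s = y or y' ≤ s; in the
  -- latter case every z ∈ L(x,y) is below s, either directly or since z ≤ y.
  Cap⊆Up : ∀ x y → Cap x y ⊆ Up x y
  Cap⊆Up x y s sCap with sCap 𝟘 (λ v _ → 𝟘-least v)
  ... | inj₂ s≈y = inj₂ s≈y
  ... | inj₁ s-above-𝟘-y′ = inj₁ s-above
    where
      s-above : U (L₂ x y ∪ ⟨ y ′ ⟩) s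
      s-above v (inj₂ v≈y′) = s-above-𝟘-y′ v (inj₂ v≈y′)
      s-above v (inj₁ vL) with sCap v vL
      ... | inj₁ s-above-v-y′ = s-above-v-y′ v (inj₁ Eq.refl)
      ... | inj₂ s≈y = trans (L₂-right vL) (reflexive (Eq.sym s≈y))

  L₂⊆L-Up : ∀ x y → L₂ x y ⊆ L (Up x y)
  L₂⊆L-Up x y w wL v (inj₁ vU)  = vU w (inj₁ wL)
  L₂⊆L-Up x y w wL v (inj₂ v≈y) = trans (L₂-right wL) (reflexive (Eq.sym v≈y))

  L₂⊆Cup : ∀ x y → L₂ x y ⊆ Cup x y
  L₂⊆Cup x y w wL = w , wL , w-below
    where
      w-below : L (U₂ w (y ′) ∪ ⟨ y ⟩) w
      w-below v (inj₁ vU)  = vU w (inj₁ Eq.refl)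
      w-below v (inj₂ v≈y) = trans (L₂-right wL) (reflexive (Eq.sym v≈y))

  -- In a modular poset the union is contained in L(x,y): since L(y',y) = {0},
  -- the modular collapse gives w ≤ z for the witness z ∈ L(x,y).
  Cup⊆L₂ : IsModular → ∀ x y → Cup x y ⊆ L₂ x y
  Cup⊆L₂ modular x y w (z , zL , wL) =
    L₂-intro (trans w≤z (L₂-left zL)) (L-∪⟨⟩ wL)
    where
      L₂y′y≤z : ∀ v → L₂ (y ′) y v → v ≤ z
      L₂y′y≤z v vL =
        trans (reflexive (proj₁ (L-compl y) v (L₂-swap v vL))) (𝟘-least z)

      w≤z : w ≤ z
      w≤z = modular-collapse modular (L₂-right zL) L₂y′y≤z w wL

theorem4 : {ℓ : Level} (P : ComplementedPoset ℓ) →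
    ComplementedPoset.IsModular P →
    (ComplementedPoset.IsPseudoOrthomodular P → ComplementedPoset.Condition P) ×
    (ComplementedPoset.Condition P → ComplementedPoset.IsPseudoOrthomodular P)
theorem4 P modular = pom⇒condition , condition⇒pom
  where
    open ComplementedPoset P
    open Cones poset
    open Complemented P

    pom⇒condition : IsPseudoOrthomodular → Condition
    pom⇒condition pom x y =
      ⊆-trans (L-antitone (Up⊆Cap x y)) (⊆-trans (proj₁ (pom x y)) (L₂⊆Cup x y))

    condition⇒pom : Condition → IsPseudoOrthomodular
    condition⇒pom condition x y =
      ⊆-trans (L-antitone (Cap⊆Up x y)) (⊆-trans (condition x y) (Cup⊆L₂ modular x y))
      , L₂⊆L-Up x y
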